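{- Let $n$ be a positive integer and write $n=4\nu+r$ with integers $\nu\geq 0$ and $0\leq r\leq 3$ (so $\nu=\lfloor n/4\rfloor$). (a) Suppose $1\leq r\leq 3$, and write $n=P_n\cdot Q_n^2$ with $P_n$ squarefree and $Q_n$ a positive integer. Then \[ F(n)=2\nu^2-\frac{\nu}{3n}\left(8\nu^2+6\nu+1\right)+\frac{1}{2}(Q_n-1)+\frac{1}{n}\sum_{k=1}^{2\nu}\mathrm{Rem}(k^2\div n). \] (b) Suppose $r=0$, i.e. $n=4\nu$ with $\nu\geq 1$, and write $\nu=\overline{P}_n\cdot\overline{Q}_n^2$ with $\overline{P}_n$ squarefree and $\overline{Q}_n$ a positive integer. Then \[ F(4\nu)=\tfrac{4}{3}\nu^2-\tfrac{1}{2}\nu-\tfrac{1}{12}+\overline{Q}_n+\frac{1}{4\nu}\sum_{k=1}^{2\nu}\mathrm{Rem}(k^2\div 4\nu). \]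
   Context: For a positive integer $n$, $F(n):=\sum_{j=1}^{\lfloor n/4\rfloor}\lfloor\sqrt{jn}\rfloor$, where $\lfloor x\rfloor$ is the floor function. For integers $a\geq 0$, $b\geq 1$, $\mathrm{Rem}(a\div b)$ denotes the smallest nonnegative remainder of $a$ upon division by $b$. Every positive integer has a unique representation as a product of a squarefree positive integer and the square of a positive integer. -}

module Defs where

open import Data.Nat using (ℕ; zero; suc; _+_; _*_; _≤?_; _/_; _%_; NonZero)
open import Data.Nat.Divisibility using (_∣_)
open import Data.Integer using (+_)
open import Data.Rational using (ℚ; 0ℚ)
import Data.Rational as Q
open import Relation.Binary.PropositionalEquality using (_≡_)
open import Relation.Nullary.Decidable using (does)
open import Data.Bool using (if_then_else_)

isqrt : ℕ → ℕ
isqrt zero = zero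
isqrt (suc m) with isqrt m
... | s = if does (suc s * suc s ≤? suc m) then suc s else s

Σ₁ : ℕ → (ℕ → ℕ) → ℕ
Σ₁ zero f = zero
Σ₁ (suc N) f = Σ₁ N f + f (suc N)

F : ℕ → ℕ
F n = Σ₁ (n / 4) (λ j → isqrt (j * n))

SquareFree : ℕ → Set
SquareFree m = ∀ d → d * d ∣ m → d ≡ 1

-- Rem(a ÷ b) for b ≥ 1 (value at b = 0 is irrelevant, set to 0)
Rem : ℕ → ℕ → ℕ
Rem a zero = zero
Rem a (suc b) = a % suc b

ℕ→ℚ : ℕ → ℚ
ℕ→ℚ m = (+ m) Q./ 1

-- rational m/d (only used with d ≥ 1; value at d = 0 is 0)
infixl 7 _//_
_//_ : ℕ → ℕ → ℚ
m // zero = 0ℚ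
m // suc d = (+ m) Q./ suc d

-- For j ≤ ν = ⌊n/4⌋ we have jn < (2ν+1)², so ⌊√(jn)⌋ counts the k ≤ 2ν with k² ≤ jn. Exchanging the
-- two sums, F(n) = Σ_{k ≤ 2ν} #{j ≤ ν : k² ≤ jn}, and for k² = qn + ρ the inner count is ν − q, or
-- ν − q + 1 when ρ = 0. Hence n F(n) + Σ k² = 2ν·nν + Σ Rem(k² ÷ n) + n·#{k ≤ 2ν : n ∣ k²}.
-- For n = P R² with P squarefree, n ∣ k² iff PR ∣ k, so the last count is ⌊2ν/(PR)⌋. It equals
-- (Q_n − 1)/2 in case (a), where Q_n is odd, and Q̄_n in case (b), where n = P̄_n (2Q̄_n)². Both
-- formulas then follow from Σ k² = 2ν(2ν+1)(4ν+1)/6 by dividing by n in ℚ.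

module Submission where

open import Defs
open import Data.Nat using (ℕ; _≤_; _*_; _+_; _^_)
open import Data.Product using (_×_)
open import Data.Rational using (ℚ) renaming (_-_ to _-ℚ_; _+_ to _+ℚ_; _*_ to _*ℚ_)
open import Relation.Binary.PropositionalEquality using (_≡_)

open import Data.Nat
open import Data.Nat.Properties
open import Data.Nat.DivMod
open import Data.Nat.Divisibility
open import Data.Nat.GCD using (gcd; gcd[m,n]∣m; gcd[m,n]∣n; gcd[m,n]≢0)
open import Data.Nat.Coprimality using (Coprime; coprime-/gcd; coprime-divisor)
open import Data.Nat.Tactic.RingSolver using (solve-∀)
open import Algebra.Properties.CommutativeSemigroup +-commutativeSemigroup
  using () renaming (interchange to +-interchange)
open import Data.Product using (_,_; proj₁; proj₂; ∃)
open import Data.Sum using (_⊎_; inj₁; inj₂)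
open import Function.Bundles using (_⇔_; mk⇔; Equivalence)
open import Relation.Nullary using (Dec; yes; no; does; ¬_; contradiction)
open import Data.Bool using (if_then_else_)
open import Relation.Binary.PropositionalEquality
  using (refl; sym; trans; cong; cong₂; subst; subst₂; module ≡-Reasoning)
import Data.Integer as ℤ
import Data.Integer.Properties as ℤ
import Data.Integer.Tactic.RingSolver as ℤ
import Data.Rational as ℚ
import Data.Rational.Properties as ℚ
open import Data.Rational.Unnormalised as ℚᵘ using (mkℚᵘ; *≡*)
import Data.Rational.Unnormalised.Properties as ℚᵘ
open import Data.Rational.Solver using (module +-*-Solver)
open import Algebra.Properties.Group ℚ.+-0-group using (∙-cancelʳ)

𝟙 : {P : Set} → Dec P → ℕ
𝟙 (yes _) = 1
𝟙 (no _)  = 0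

𝟙-yes : {P : Set} (P? : Dec P) → P → 𝟙 P? ≡ 1
𝟙-yes (yes _) _ = refl
𝟙-yes (no ¬p) p = contradiction p ¬p

𝟙-no : {P : Set} (P? : Dec P) → ¬ P → 𝟙 P? ≡ 0
𝟙-no (yes p) ¬p = contradiction p ¬p
𝟙-no (no _)  _  = refl

𝟙-cong : {P Q : Set} (P? : Dec P) (Q? : Dec Q) → P ⇔ Q → 𝟙 P? ≡ 𝟙 Q?
𝟙-cong (yes p) Q? P⇔Q = sym (𝟙-yes Q? (Equivalence.to P⇔Q p))
𝟙-cong (no ¬p) Q? P⇔Q = sym (𝟙-no Q? (λ q → ¬p (Equivalence.from P⇔Q q)))

Σ₁-cong : ∀ N {f g : ℕ → ℕ} → (∀ i → 1 ≤ i → i ≤ N → f i ≡ g i) → Σ₁ N f ≡ Σ₁ N g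
Σ₁-cong zero    f≗g = refl
Σ₁-cong (suc N) f≗g =
  cong₂ _+_ (Σ₁-cong N (λ i 1≤i i≤N → f≗g i 1≤i (m≤n⇒m≤1+n i≤N))) (f≗g (suc N) (s≤s z≤n) ≤-refl)

Σ₁-const : ∀ N c → Σ₁ N (λ _ → c) ≡ N * c
Σ₁-const zero    c = refl
Σ₁-const (suc N) c = trans (cong (_+ c) (Σ₁-const N c)) (+-comm (N * c) c)

Σ₁-zero : ∀ N {f : ℕ → ℕ} → (∀ i → 1 ≤ i → i ≤ N → f i ≡ 0) → Σ₁ N f ≡ 0
Σ₁-zero N f≗0 = trans (Σ₁-cong N f≗0) (trans (Σ₁-const N 0) (*-zeroʳ N))

Σ₁-distrib-+ : ∀ N (f g : ℕ → ℕ) → Σ₁ N (λ i → f i + g i) ≡ Σ₁ N f + Σ₁ N g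
Σ₁-distrib-+ zero    f g = refl
Σ₁-distrib-+ (suc N) f g = begin
  Σ₁ N (λ i → f i + g i) + (f (suc N) + g (suc N))
    ≡⟨ cong (_+ (f (suc N) + g (suc N))) (Σ₁-distrib-+ N f g) ⟩
  Σ₁ N f + Σ₁ N g + (f (suc N) + g (suc N))
    ≡⟨ +-interchange (Σ₁ N f) (Σ₁ N g) (f (suc N)) (g (suc N)) ⟩
  Σ₁ N f + f (suc N) + (Σ₁ N g + g (suc N)) ∎
  where open ≡-Reasoning

Σ₁-distribˡ-* : ∀ N c (f : ℕ → ℕ) → Σ₁ N (λ i → c * f i) ≡ c * Σ₁ N f
Σ₁-distribˡ-* zero    c f = sym (*-zeroʳ c)
Σ₁-distribˡ-* (suc N) c f =
  trans (cong (_+ c * f (suc N)) (Σ₁-distribˡ-* N c f)) (sym (*-distribˡ-+ c (Σ₁ N f) (f (suc N))))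

Σ₁-comm : ∀ M N (g : ℕ → ℕ → ℕ) → Σ₁ M (λ i → Σ₁ N (g i)) ≡ Σ₁ N (λ j → Σ₁ M (λ i → g i j))
Σ₁-comm zero    N g = sym (Σ₁-zero N (λ _ _ _ → refl))
Σ₁-comm (suc M) N g =
  trans (cong (_+ Σ₁ N (g (suc M))) (Σ₁-comm M N g))
        (sym (Σ₁-distrib-+ N (λ j → Σ₁ M (λ i → g i j)) (g (suc M))))

Σ₁-split : ∀ a b (f : ℕ → ℕ) → Σ₁ (a + b) f ≡ Σ₁ a f + Σ₁ b (λ i → f (a + i))
Σ₁-split a zero    f = trans (cong (λ m → Σ₁ m f) (+-identityʳ a)) (sym (+-identityʳ (Σ₁ a f)))
Σ₁-split a (suc b) f = begin
  Σ₁ (a + suc b) f                              ≡⟨ cong (λ m → Σ₁ m f) (+-suc a b) ⟩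
  Σ₁ (a + b) f + f (suc (a + b))                ≡⟨ cong₂ _+_ (Σ₁-split a b f) (cong f (sym (+-suc a b))) ⟩
  Σ₁ a f + Σ₁ b (λ i → f (a + i)) + f (a + suc b) ≡⟨ +-assoc (Σ₁ a f) _ _ ⟩
  Σ₁ a f + (Σ₁ b (λ i → f (a + i)) + f (a + suc b)) ∎
  where open ≡-Reasoning

Σ₁-𝟙-≤ : ∀ K s → Σ₁ K (λ k → 𝟙 (k ≤? s)) ≡ K ⊓ s
Σ₁-𝟙-≤ zero    s = refl
Σ₁-𝟙-≤ (suc K) s with suc K ≤? s
... | yes K<s = begin
  Σ₁ K (λ k → 𝟙 (k ≤? s)) + 1 ≡⟨ cong (_+ 1) (trans (Σ₁-𝟙-≤ K s) (m≤n⇒m⊓n≡m (<⇒≤ K<s))) ⟩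
  K + 1                       ≡⟨ +-comm K 1 ⟩
  suc K                       ≡⟨ m≤n⇒m⊓n≡m K<s ⟨
  suc K ⊓ s ∎
  where open ≡-Reasoning
... | no K≮s = begin
  Σ₁ K (λ k → 𝟙 (k ≤? s)) + 0 ≡⟨ +-identityʳ _ ⟩
  Σ₁ K (λ k → 𝟙 (k ≤? s))     ≡⟨ trans (Σ₁-𝟙-≤ K s) (m≥n⇒m⊓n≡n (≤-pred (≰⇒> K≮s))) ⟩
  s                           ≡⟨ m≥n⇒m⊓n≡n (<⇒≤ (≰⇒> K≮s)) ⟨
  suc K ⊓ s ∎
  where open ≡-Reasoning

Σ₁-𝟙-≥ : ∀ N c → 1 ≤ c → c ≤ suc N → Σ₁ N (λ j → 𝟙 (c ≤? j)) + c ≡ suc N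
Σ₁-𝟙-≥ zero    .1 (s≤s z≤n) (s≤s z≤n) = refl
Σ₁-𝟙-≥ (suc N) c  1≤c       c≤2+N    with c ≤? suc N
... | yes c≤1+N = begin
  Σ₁ N (λ j → 𝟙 (c ≤? j)) + 1 + c ≡⟨ +-assoc _ 1 c ⟩
  Σ₁ N (λ j → 𝟙 (c ≤? j)) + suc c ≡⟨ +-suc _ c ⟩
  suc (Σ₁ N (λ j → 𝟙 (c ≤? j)) + c) ≡⟨ cong suc (Σ₁-𝟙-≥ N c 1≤c c≤1+N) ⟩
  suc (suc N) ∎
  where open ≡-Reasoning
... | no c≰1+N with ≤-antisym c≤2+N (≰⇒> c≰1+N)
...   | refl = cong (λ s → s + 0 + suc (suc N)) (Σ₁-zero N (λ j _ j≤N → 𝟙-no _ (λ c≤j → <⇒≱ (s≤s (m≤n⇒m≤1+n j≤N)) c≤j)))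

Σ₁-𝟙-∣ : ∀ D .{{_ : NonZero D}} t u → u < D → Σ₁ (t * D + u) (λ k → 𝟙 (D ∣? k)) ≡ t
Σ₁-𝟙-∣ D zero u u<D = Σ₁-zero u (λ k 1≤k k≤u → 𝟙-no _ (λ D∣k →
  <⇒≱ (≤-<-trans k≤u u<D) (∣⇒≤ {{≢-nonZero (m<n⇒n≢0 1≤k)}} D∣k)))
Σ₁-𝟙-∣ D@(suc d) (suc t) u u<D = begin
  Σ₁ (D + t * D + u) f               ≡⟨ cong (λ m → Σ₁ m f) (+-assoc D (t * D) u) ⟩
  Σ₁ (D + (t * D + u)) f             ≡⟨ Σ₁-split D (t * D + u) f ⟩
  Σ₁ D f + Σ₁ (t * D + u) (λ i → f (D + i))
    ≡⟨ cong₂ _+_ first-period (Σ₁-cong (t * D + u) (λ i _ _ → 𝟙-cong _ _ D∣D+i⇔D∣i)) ⟩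
  1 + Σ₁ (t * D + u) f               ≡⟨ cong suc (Σ₁-𝟙-∣ D t u u<D) ⟩
  suc t ∎
  where
  open ≡-Reasoning
  f : ℕ → ℕ
  f k = 𝟙 (D ∣? k)
  first-period : Σ₁ D f ≡ 1
  first-period = cong₂ _+_ (Σ₁-𝟙-∣ D zero d ≤-refl) (𝟙-yes _ ∣-refl)
  D∣D+i⇔D∣i : ∀ {i} → D ∣ D + i ⇔ D ∣ i
  D∣D+i⇔D∣i = mk⇔ (λ D∣D+i → ∣m+n∣m⇒∣n D∣D+i ∣-refl) (∣m∣n⇒∣m+n ∣-refl)

square-cancel-< : ∀ {a b} → a * a < b * b → a < b
square-cancel-< {a} {b} a²<b² with a <? b
... | yes a<b = a<b
... | no  a≮b = contradiction a²<b² (≤⇒≯ (*-mono-≤ (≮⇒≥ a≮b) (≮⇒≥ a≮b)))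

isqrt-step : ∀ m s → s * s ≤ m → m < suc s * suc s → (d : Dec (suc s * suc s ≤ suc m)) →
  let s′ = if does d then suc s else s in s′ * s′ ≤ suc m × suc m < suc s′ * suc s′
isqrt-step m s _    m<[1+s]² (yes [1+s]²≤1+m) = [1+s]²≤1+m , ≤-<-trans m<[1+s]² (*-mono-< (n<1+n (suc s)) (n<1+n (suc s)))
isqrt-step m s s²≤m _        (no [1+s]²≰1+m)  = m≤n⇒m≤1+n s²≤m , ≰⇒> [1+s]²≰1+m

isqrt-correct : ∀ m → isqrt m * isqrt m ≤ m × m < suc (isqrt m) * suc (isqrt m)
isqrt-correct zero    = z≤n , s≤s z≤n
isqrt-correct (suc m) = isqrt-step m (isqrt m) (proj₁ (isqrt-correct m)) (proj₂ (isqrt-correct m))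
  (suc (isqrt m) * suc (isqrt m) ≤? suc m)

≤isqrt⇔square≤ : ∀ m k → k ≤ isqrt m ⇔ k * k ≤ m
≤isqrt⇔square≤ m k = mk⇔
  (λ k≤s → ≤-trans (*-mono-≤ k≤s k≤s) (proj₁ (isqrt-correct m)))
  (λ k²≤m → ≤-pred (square-cancel-< (≤-<-trans k²≤m (proj₂ (isqrt-correct m)))))

isqrt≡Σ₁-𝟙 : ∀ m K → m < suc K * suc K → isqrt m ≡ Σ₁ K (λ k → 𝟙 (k * k ≤? m))
isqrt≡Σ₁-𝟙 m K m<[1+K]² = begin
  isqrt m                             ≡⟨ m≥n⇒m⊓n≡n s≤K ⟨
  K ⊓ isqrt m                         ≡⟨ Σ₁-𝟙-≤ K (isqrt m) ⟨
  Σ₁ K (λ k → 𝟙 (k ≤? isqrt m))       ≡⟨ Σ₁-cong K (λ k _ _ → 𝟙-cong _ _ (≤isqrt⇔square≤ m k)) ⟩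
  Σ₁ K (λ k → 𝟙 (k * k ≤? m)) ∎
  where
  open ≡-Reasoning
  s≤K : isqrt m ≤ K
  s≤K = ≤-pred (square-cancel-< (≤-<-trans (proj₁ (isqrt-correct m)) m<[1+K]²))

Σ₁-𝟙[x≤j*n]-ceiling : ∀ n ν x c → (∀ j → x ≤ j * n ⇔ c ≤ j) → 1 ≤ c → c ≤ suc ν →
  Σ₁ ν (λ j → 𝟙 (x ≤? j * n)) + c ≡ suc ν
Σ₁-𝟙[x≤j*n]-ceiling n ν x c x≤jn⇔c≤j 1≤c c≤1+ν =
  trans (cong (_+ c) (Σ₁-cong ν (λ j _ _ → 𝟙-cong _ _ (x≤jn⇔c≤j j)))) (Σ₁-𝟙-≥ ν c 1≤c c≤1+ν)

-- #{j ≤ ν : x ≤ jn} = ν + 1 − ⌈x/n⌉, multiplied by n and rearranged.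
Σ₁-𝟙[x≤j*n] : ∀ n .{{_ : NonZero n}} ν x → 1 ≤ x → x ≤ ν * n →
  n * Σ₁ ν (λ j → 𝟙 (x ≤? j * n)) + x ≡ n * ν + x % n + n * 𝟙 (n ∣? x)
Σ₁-𝟙[x≤j*n] n ν x 1≤x x≤νn with n ∣? x
... | yes (divides q refl) = begin
  n * Σ + q * n       ≡⟨ factor n Σ q ⟩
  n * (Σ + q)         ≡⟨ cong (n *_) (Σ₁-𝟙[x≤j*n]-ceiling n ν (q * n) q x≤jn⇔q≤j 1≤q (m≤n⇒m≤1+n q≤ν)) ⟩
  n * suc ν           ≡⟨ expand n ν ⟩
  n * ν + 0 + n * 1   ≡⟨ cong (λ ρ → n * ν + ρ + n * 1) (m*n%n≡0 q n) ⟨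
  n * ν + q * n % n + n * 1 ∎
  where
  open ≡-Reasoning
  Σ = Σ₁ ν (λ j → 𝟙 (q * n ≤? j * n))
  factor : ∀ n s q → n * s + q * n ≡ n * (s + q)
  factor = solve-∀
  expand : ∀ n ν → n * suc ν ≡ n * ν + 0 + n * 1
  expand = solve-∀
  x≤jn⇔q≤j : ∀ j → q * n ≤ j * n ⇔ q ≤ j
  x≤jn⇔q≤j j = mk⇔ (*-cancelʳ-≤ q j n) (*-monoˡ-≤ n)
  1≤q : 1 ≤ q
  1≤q = *-cancelʳ-≤ 1 q n (≤-trans (≤-reflexive (*-identityˡ n)) (∣⇒≤ {{≢-nonZero (m<n⇒n≢0 1≤x)}} (divides q refl)))
  q≤ν : q ≤ ν
  q≤ν = *-cancelʳ-≤ q ν n x≤νn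
... | no n∤x = begin
  n * Σ + x                 ≡⟨ cong (n * Σ +_) (m≡m%n+[m/n]*n x n) ⟩
  n * Σ + (ρ + q * n)       ≡⟨ factor n Σ q ρ ⟩
  n * (Σ + q) + ρ           ≡⟨ cong (λ m → n * m + ρ) Σ+q≡ν ⟩
  n * ν + ρ                 ≡⟨ trans (cong (n * ν + ρ +_) (*-zeroʳ n)) (+-identityʳ _) ⟨
  n * ν + ρ + n * 0 ∎
  where
  open ≡-Reasoning
  Σ = Σ₁ ν (λ j → 𝟙 (x ≤? j * n))
  ρ = x % n
  q = x / n
  factor : ∀ n s q ρ → n * s + (ρ + q * n) ≡ n * (s + q) + ρ
  factor = solve-∀
  x≡ρ+qn : x ≡ ρ + q * n
  x≡ρ+qn = m≡m%n+[m/n]*n x n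
  qn<x : q * n < x
  qn<x = subst (q * n <_) (sym x≡ρ+qn)
    (m<n+m (q * n) (n≢0⇒n>0 (λ ρ≡0 → n∤x (m%n≡0⇒n∣m x n ρ≡0))))
  x<[1+q]n : x < suc q * n
  x<[1+q]n = subst (_< suc q * n) (sym x≡ρ+qn) (+-monoˡ-< (q * n) (m%n<n x n))
  x≤jn⇔q<j : ∀ j → x ≤ j * n ⇔ suc q ≤ j
  x≤jn⇔q<j j = mk⇔
    (λ x≤jn → ≰⇒> (λ j≤q → <⇒≱ (≤-<-trans (*-monoˡ-≤ n j≤q) qn<x) x≤jn))
    (λ q<j → ≤-trans (<⇒≤ x<[1+q]n) (*-monoˡ-≤ n q<j))
  Σ+q≡ν : Σ + q ≡ ν
  Σ+q≡ν = suc-injective (trans (sym (+-suc Σ q))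
    (Σ₁-𝟙[x≤j*n]-ceiling n ν x (suc q) x≤jn⇔q<j (s≤s z≤n) (m≤n⇒m≤1+n (*-cancelʳ-< _ q ν (<-≤-trans qn<x x≤νn)))))

Σ₁-isqrt-identity : ∀ n .{{_ : NonZero n}} ν K → K * K ≤ ν * n → ν * n < suc K * suc K →
  n * Σ₁ ν (λ j → isqrt (j * n)) + Σ₁ K (λ k → k * k)
    ≡ K * (n * ν) + Σ₁ K (λ k → k * k % n) + n * Σ₁ K (λ k → 𝟙 (n ∣? k * k))
Σ₁-isqrt-identity n ν K K²≤νn νn<[1+K]² = begin
  n * Σ₁ ν (λ j → isqrt (j * n)) + T
    ≡⟨ cong (λ s → n * s + T) (Σ₁-cong ν (λ j _ j≤ν → isqrt≡Σ₁-𝟙 (j * n) K (≤-<-trans (*-monoˡ-≤ n j≤ν) νn<[1+K]²))) ⟩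
  n * Σ₁ ν (λ j → Σ₁ K (λ k → 𝟙 (k * k ≤? j * n))) + T
    ≡⟨ cong (λ s → n * s + T) (Σ₁-comm ν K (λ j k → 𝟙 (k * k ≤? j * n))) ⟩
  n * Σ₁ K count + T
    ≡⟨ cong (_+ T) (Σ₁-distribˡ-* K n count) ⟨
  Σ₁ K (λ k → n * count k) + T
    ≡⟨ Σ₁-distrib-+ K (λ k → n * count k) (λ k → k * k) ⟨
  Σ₁ K (λ k → n * count k + k * k)
    ≡⟨ Σ₁-cong K (λ k 1≤k k≤K → Σ₁-𝟙[x≤j*n] n ν (k * k) (*-mono-≤ 1≤k 1≤k) (≤-trans (*-mono-≤ k≤K k≤K) K²≤νn)) ⟩
  Σ₁ K (λ k → n * ν + k * k % n + n * 𝟙 (n ∣? k * k))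
    ≡⟨ Σ₁-distrib-+ K (λ k → n * ν + k * k % n) (λ k → n * 𝟙 (n ∣? k * k)) ⟩
  Σ₁ K (λ k → n * ν + k * k % n) + Σ₁ K (λ k → n * 𝟙 (n ∣? k * k))
    ≡⟨ cong₂ _+_ (trans (Σ₁-distrib-+ K (λ _ → n * ν) (λ k → k * k % n)) (cong (_+ Σ₁ K (λ k → k * k % n)) (Σ₁-const K (n * ν))))
                 (Σ₁-distribˡ-* K n (λ k → 𝟙 (n ∣? k * k))) ⟩
  K * (n * ν) + Σ₁ K (λ k → k * k % n) + n * Σ₁ K (λ k → 𝟙 (n ∣? k * k)) ∎
  where
  open ≡-Reasoning
  T = Σ₁ K (λ k → k * k)
  count : ℕ → ℕ
  count k = Σ₁ ν (λ j → 𝟙 (k * k ≤? j * n))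

Rem≡% : ∀ a n .{{_ : NonZero n}} → Rem a n ≡ a % n
Rem≡% a (suc n) = refl

n/4≡ν : ∀ {n ν r} → n ≡ 4 * ν + r → r ≤ 3 → n / 4 ≡ ν
n/4≡ν {n} {ν} {r} refl r≤3 = begin
  (4 * ν + r) / 4     ≡⟨ +-distrib-/-∣ˡ {4 * ν} r (divides ν (*-comm 4 ν)) ⟩
  4 * ν / 4 + r / 4   ≡⟨ cong₂ _+_ (trans (/-congˡ (*-comm 4 ν)) (m*n/n≡m ν 4)) (m<n⇒m/n≡0 (s≤s r≤3)) ⟩
  ν + 0               ≡⟨ +-identityʳ ν ⟩
  ν ∎
  where open ≡-Reasoning

F-identity : ∀ n .{{_ : NonZero n}} ν r → n ≡ 4 * ν + r → r ≤ 3 →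
  n * F n + Σ₁ (2 * ν) (λ k → k * k)
    ≡ 2 * ν * (n * ν) + Σ₁ (2 * ν) (λ k → Rem (k ^ 2) n) + n * Σ₁ (2 * ν) (λ k → 𝟙 (n ∣? k * k))
F-identity n ν r n≡4ν+r r≤3 = begin
  n * F n + T
    ≡⟨ cong (λ m → n * Σ₁ m (λ j → isqrt (j * n)) + T) (n/4≡ν {ν = ν} n≡4ν+r r≤3) ⟩
  n * Σ₁ ν (λ j → isqrt (j * n)) + T
    ≡⟨ Σ₁-isqrt-identity n ν (2 * ν) [2ν]²≤νn νn<[2ν+1]² ⟩
  2 * ν * (n * ν) + Σ₁ (2 * ν) (λ k → k * k % n) + C
    ≡⟨ cong (λ S → 2 * ν * (n * ν) + S + C) (Σ₁-cong (2 * ν) (λ k _ _ → sym (Rem-square k))) ⟩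
  2 * ν * (n * ν) + Σ₁ (2 * ν) (λ k → Rem (k ^ 2) n) + C ∎
  where
  open ≡-Reasoning
  T = Σ₁ (2 * ν) (λ k → k * k)
  C = n * Σ₁ (2 * ν) (λ k → 𝟙 (n ∣? k * k))
  Rem-square : ∀ k → Rem (k ^ 2) n ≡ k * k % n
  Rem-square k = trans (Rem≡% (k ^ 2) n) (cong (λ m → k * m % n) (*-identityʳ k))
  square-even : ∀ ν → ν * (4 * ν) ≡ 2 * ν * (2 * ν)
  square-even = solve-∀
  square-odd : ∀ ν → suc (ν * (4 * ν + 3) + ν) ≡ suc (2 * ν) * suc (2 * ν)
  square-odd = solve-∀
  [2ν]²≤νn : 2 * ν * (2 * ν) ≤ ν * n
  [2ν]²≤νn = subst (_≤ ν * n) (square-even ν)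
    (*-monoʳ-≤ ν (subst (4 * ν ≤_) (sym n≡4ν+r) (m≤m+n (4 * ν) r)))
  νn<[2ν+1]² : ν * n < suc (2 * ν) * suc (2 * ν)
  νn<[2ν+1]² = ≤-<-trans (*-monoʳ-≤ ν (subst (_≤ 4 * ν + 3) (sym n≡4ν+r) (+-monoʳ-≤ (4 * ν) r≤3)))
    (subst (ν * (4 * ν + 3) <_) (square-odd ν) (s≤s (m≤m+n _ ν)))

module DivideByGcd (m k : ℕ) .{{_ : NonZero m}} where

  g : ℕ
  g = gcd m k

  instance
    g≢0 : NonZero g
    g≢0 = ≢-nonZero (gcd[m,n]≢0 m k (inj₁ (≢-nonZero⁻¹ m)))

  a b : ℕ
  a = m / g
  b = k / g

  m≡a*g : m ≡ a * g
  m≡a*g = sym (m/n*n≡m (gcd[m,n]∣m m k))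

  k≡b*g : k ≡ b * g
  k≡b*g = sym (m/n*n≡m (gcd[m,n]∣n m k))

  coprime : Coprime a b
  coprime = coprime-/gcd m k

  m≡g : a ≡ 1 → m ≡ g
  m≡g a≡1 = trans m≡a*g (trans (cong (_* g) a≡1) (*-identityˡ g))

coprime-square∣square⇒≡1 : ∀ {a b g} .{{_ : NonZero g}} → Coprime a b →
  a * g * (a * g) ∣ b * g * (b * g) → a ≡ 1
coprime-square∣square⇒≡1 {a} {b} {g} coprime [ag]²∣[bg]² =
  coprime (∣-refl , coprime-divisor coprime (m*n∣⇒m∣ a a a²∣b²))
  where
  instance
    g²≢0 : NonZero (g * g)
    g²≢0 = m*n≢0 g g
  regroup : ∀ x y → x * y * (x * y) ≡ x * x * (y * y)
  regroup = solve-∀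
  a²∣b² : a * a ∣ b * b
  a²∣b² = *-cancelʳ-∣ (g * g) (subst₂ _∣_ (regroup a g) (regroup b g) [ag]²∣[bg]²)

coprime-∣square⇒∣ : ∀ {a b g} .{{_ : NonZero g}} → Coprime a b → a * g ∣ b * g * (b * g) → a ∣ g
coprime-∣square⇒∣ {a} {b} {g} coprime ag∣[bg]² =
  coprime-divisor coprime (coprime-divisor coprime (*-cancelʳ-∣ g (subst (a * g ∣_) (regroup b g) ag∣[bg]²)))
  where
  regroup : ∀ b g → b * g * (b * g) ≡ b * (b * g) * g
  regroup = solve-∀

square∣square⇒∣ : ∀ {R k} .{{_ : NonZero R}} → R * R ∣ k * k → R ∣ k
square∣square⇒∣ {R} {k} R²∣k² = divides b (trans k≡b*g (cong (b *_) (sym R≡g)))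
  where
  open DivideByGcd R k
  R≡g : R ≡ g
  R≡g = m≡g (coprime-square∣square⇒≡1 coprime (subst₂ _∣_ (cong₂ _*_ m≡a*g m≡a*g) (cong₂ _*_ k≡b*g k≡b*g) R²∣k²))

SquareFree⇒NonZero : ∀ {P} → SquareFree P → NonZero P
SquareFree⇒NonZero {zero}  sf with sf 2 (4 ∣0)
... | ()
SquareFree⇒NonZero {suc P} sf = _

squarefree∣square⇒∣ : ∀ {P m} → SquareFree P → P ∣ m * m → P ∣ m
squarefree∣square⇒∣ {P} {m} sf P∣m² = divides b (trans k≡b*g (cong (b *_) (sym P≡g)))
  where
  open DivideByGcd P m {{SquareFree⇒NonZero sf}}
  a∣g : a ∣ g
  a∣g = coprime-∣square⇒∣ coprime (subst₂ _∣_ m≡a*g (cong₂ _*_ k≡b*g k≡b*g) P∣m²)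
  P≡g : P ≡ g
  P≡g = m≡g (sf a (subst (a * a ∣_) (sym m≡a*g) (*-monoʳ-∣ a a∣g)))

squarefree*square∣square⇔∣ : ∀ {P R k} → SquareFree P → .{{_ : NonZero R}} →
  P * (R * R) ∣ k * k ⇔ P * R ∣ k
squarefree*square∣square⇔∣ {P} {R} {k} sf = mk⇔ to from
  where
  to : P * (R * R) ∣ k * k → P * R ∣ k
  to PR²∣k² = subst (P * R ∣_) (sym k≡cR) (*-monoˡ-∣ R (squarefree∣square⇒∣ {P} {c} sf P∣c²))
    where
    R∣k : R ∣ k
    R∣k = square∣square⇒∣ {R} {k} (m*n∣⇒n∣ P (R * R) PR²∣k²)
    c = quotient R∣k
    k≡cR : k ≡ c * R
    k≡cR = m∣n⇒n≡quotient*m R∣k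
    regroup : ∀ c R → c * R * (c * R) ≡ c * c * (R * R)
    regroup = solve-∀
    P∣c² : P ∣ c * c
    P∣c² = *-cancelʳ-∣ (R * R) {{m*n≢0 R R}}
      (subst (P * (R * R) ∣_) (trans (cong₂ _*_ k≡cR k≡cR) (regroup c R)) PR²∣k²)
  from : P * R ∣ k → P * (R * R) ∣ k * k
  from (divides c refl) = divides (c * c * P) (regroup P R c)
    where
    regroup : ∀ P R c → c * (P * R) * (c * (P * R)) ≡ c * c * P * (P * (R * R))
    regroup = solve-∀

Σ₁-𝟙[n∣k²] : ∀ {n P R} K t u → SquareFree P → .{{_ : NonZero R}} →
  n ≡ P * (R * R) → K ≡ t * (P * R) + u → u < P * R → Σ₁ K (λ k → 𝟙 (n ∣? k * k)) ≡ t
Σ₁-𝟙[n∣k²] {P = P} {R} _ t u sf refl refl u<PR = trans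
  (Σ₁-cong (t * (P * R) + u) (λ k _ _ → 𝟙-cong _ _ (squarefree*square∣square⇔∣ sf)))
  (Σ₁-𝟙-∣ (P * R) {{m*n≢0 P R {{SquareFree⇒NonZero sf}}}} t u u<PR)

even⊎odd : ∀ m → (∃ λ s → m ≡ 2 * s) ⊎ (∃ λ t → m ≡ suc (2 * t))
even⊎odd zero = inj₁ (0 , refl)
even⊎odd (suc m) with even⊎odd m
... | inj₁ (s , refl) = inj₂ (s , refl)
... | inj₂ (t , refl) = inj₁ (suc t , cong suc (sym (+-suc t (t + 0))))

4*ν+r≡4*M⇒r≡0 : ∀ ν M {r} → 4 * ν + r ≡ 4 * M → r ≤ 3 → r ≡ 0
4*ν+r≡4*M⇒r≡0 ν M {r} eq r≤3 = begin
  r                 ≡⟨ m<n⇒m%n≡m (s≤s r≤3) ⟨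
  r % 4             ≡⟨ [m+kn]%n≡m%n r ν 4 ⟨
  (r + ν * 4) % 4   ≡⟨ %-congˡ (trans (trans (+-comm r (ν * 4)) (cong (_+ r) (*-comm ν 4))) eq) ⟩
  4 * M % 4         ≡⟨ %-congˡ (*-comm 4 M) ⟩
  M * 4 % 4         ≡⟨ m*n%n≡0 M 4 ⟩
  0 ∎
  where open ≡-Reasoning

2*K+r≡2*A+D⇒∃[u<D]K≡A+u : ∀ K A D r → 2 * K + r ≡ 2 * A + D → 1 ≤ r → r ≤ D → ∃ λ u → K ≡ A + u × u < D
2*K+r≡2*A+D⇒∃[u<D]K≡A+u K A D r eq 1≤r r≤D = K ∸ A , sym (m+[n∸m]≡n A≤K) , u<D
  where
  A≤K : A ≤ K
  A≤K = *-cancelˡ-≤ 2 (+-cancelʳ-≤ r (2 * A) (2 * K)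
    (subst (2 * A + r ≤_) (sym eq) (+-monoʳ-≤ (2 * A) r≤D)))
  regroup : ∀ A u r → 2 * (A + u) + r ≡ 2 * A + (2 * u + r)
  regroup = solve-∀
  2u+r≡D : 2 * (K ∸ A) + r ≡ D
  2u+r≡D = +-cancelˡ-≡ (2 * A) _ _
    (trans (sym (regroup A (K ∸ A) r)) (trans (cong (λ m → 2 * m + r) (m+[n∸m]≡n A≤K)) eq))
  u<D : K ∸ A < D
  u<D = subst (K ∸ A <_) 2u+r≡D (<-≤-trans (m<m+n (K ∸ A) 1≤r) (+-monoˡ-≤ r (m≤n*m (K ∸ A) 2)))

Σ₁-𝟙[n∣k²]-odd : ∀ {n ν r P Q} → n ≡ 4 * ν + r → 1 ≤ r → r ≤ 3 → SquareFree P → n ≡ P * (Q * Q) →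
  2 * Σ₁ (2 * ν) (λ k → 𝟙 (n ∣? k * k)) + 1 ≡ Q
Σ₁-𝟙[n∣k²]-odd {n} {ν} {r} {P} {Q} n≡4ν+r 1≤r r≤3 sf n≡PQ² with even⊎odd Q
... | inj₁ (s , refl) = contradiction (4*ν+r≡4*M⇒r≡0 ν (P * (s * s)) (trans (sym n≡4ν+r) (trans n≡PQ² (regroup P s))) r≤3)
                                      (λ r≡0 → <⇒≢ 1≤r (sym r≡0))
  where
  regroup : ∀ P s → P * (2 * s * (2 * s)) ≡ 4 * (P * (s * s))
  regroup = solve-∀
... | inj₂ (t , refl) with 2*K+r≡2*A+D⇒∃[u<D]K≡A+u (2 * ν) (t * (P * Q)) (P * Q) r n≡2tD+D 1≤r r≤PQ
  where
  regroup : ∀ ν r → 2 * (2 * ν) + r ≡ 4 * ν + r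
  regroup = solve-∀
  expand : ∀ P t → P * (suc (2 * t) * suc (2 * t)) ≡ 2 * (t * (P * suc (2 * t))) + P * suc (2 * t)
  expand = solve-∀
  n≡2tD+D : 2 * (2 * ν) + r ≡ 2 * (t * (P * Q)) + P * Q
  n≡2tD+D = trans (regroup ν r) (trans (sym n≡4ν+r) (trans n≡PQ² (expand P t)))
  r≤P[2t+1] : ∀ t → n ≡ P * (suc (2 * t) * suc (2 * t)) → r ≤ P * suc (2 * t)
  r≤P[2t+1] zero    n≡P   = subst (r ≤_) (trans (sym n≡4ν+r) n≡P) (m≤n+m r (4 * ν))
  r≤P[2t+1] (suc t) _     = ≤-trans r≤3 (≤-trans (s≤s (*-monoʳ-≤ 2 (s≤s z≤n)))
                                                (m≤n*m (suc (2 * suc t)) P {{SquareFree⇒NonZero sf}}))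
  r≤PQ : r ≤ P * Q
  r≤PQ = r≤P[2t+1] t n≡PQ²
... | u , 2ν≡tD+u , u<D = trans (cong (λ C → 2 * C + 1) (Σ₁-𝟙[n∣k²] (2 * ν) t u sf n≡PQ² 2ν≡tD+u u<D)) (+-comm (2 * t) 1)

Σ₁-𝟙[n∣k²]-even : ∀ {ν P Q} → SquareFree P → 1 ≤ Q → ν ≡ P * (Q * Q) →
  Σ₁ (2 * ν) (λ k → 𝟙 (4 * ν ∣? k * k)) ≡ Q
Σ₁-𝟙[n∣k²]-even {ν} {P} {Q} sf 1≤Q ν≡PQ² =
  Σ₁-𝟙[n∣k²] {4 * ν} {P} {2 * Q} (2 * ν) Q 0 sf {{2Q≢0}} (trans (cong (4 *_) ν≡PQ²) (regroup₁ P Q))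
    (trans (cong (2 *_) ν≡PQ²) (regroup₂ P Q)) (n≢0⇒n>0 (≢-nonZero⁻¹ (P * (2 * Q)) {{2PQ≢0}}))
  where
  2Q≢0 : NonZero (2 * Q)
  2Q≢0 = m*n≢0 2 Q {{_}} {{>-nonZero 1≤Q}}
  2PQ≢0 : NonZero (P * (2 * Q))
  2PQ≢0 = m*n≢0 P (2 * Q) {{SquareFree⇒NonZero sf}} {{2Q≢0}}
  regroup₁ : ∀ P Q → 4 * (P * (Q * Q)) ≡ P * (2 * Q * (2 * Q))
  regroup₁ = solve-∀
  regroup₂ : ∀ P Q → 2 * (P * (Q * Q)) ≡ Q * (P * (2 * Q)) + 0
  regroup₂ = solve-∀

Σ₁-squares : ∀ m → 6 * Σ₁ m (λ k → k * k) ≡ m * (m + 1) * (2 * m + 1)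
Σ₁-squares zero    = refl
Σ₁-squares (suc m) = begin
  6 * (Σ₁ m (λ k → k * k) + suc m * suc m)       ≡⟨ *-distribˡ-+ 6 (Σ₁ m (λ k → k * k)) (suc m * suc m) ⟩
  6 * Σ₁ m (λ k → k * k) + 6 * (suc m * suc m)   ≡⟨ cong (_+ 6 * (suc m * suc m)) (Σ₁-squares m) ⟩
  m * (m + 1) * (2 * m + 1) + 6 * (suc m * suc m) ≡⟨ step m ⟩
  suc m * (suc m + 1) * (2 * suc m + 1) ∎
  where
  open ≡-Reasoning
  step : ∀ m → m * (m + 1) * (2 * m + 1) + 6 * ((1 + m) * (1 + m)) ≡ (1 + m) * ((1 + m) + 1) * (2 * (1 + m) + 1)
  step = solve-∀

-- Part (a) multiplied by 6n, with the subtracted terms moved to the left.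
F-identity-odd : ∀ n .{{_ : NonZero n}} ν r P Q → n ≡ 4 * ν + r → 1 ≤ r → r ≤ 3 →
  SquareFree P → n ≡ P * (Q * Q) →
  6 * n * F n + (2 * (ν * (8 * ν * ν + 6 * ν + 1)) + 3 * n)
    ≡ 6 * n * (2 * ν * ν) + 3 * n * Q + 6 * Σ₁ (2 * ν) (λ k → Rem (k ^ 2) n)
F-identity-odd n ν r P Q n≡4ν+r 1≤r r≤3 sf n≡PQ² = begin
  6 * n * F n + (2 * (ν * (8 * ν * ν + 6 * ν + 1)) + 3 * n)
    ≡⟨ cong (λ x → 6 * n * F n + (x + 3 * n)) (trans (twice-cubic ν) (sym (Σ₁-squares (2 * ν)))) ⟩
  6 * n * F n + (6 * T + 3 * n)              ≡⟨ regroup₁ n (F n) T ⟩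
  6 * (n * F n + T) + 3 * n                  ≡⟨ cong (λ x → 6 * x + 3 * n) (F-identity n ν r n≡4ν+r r≤3) ⟩
  6 * (2 * ν * (n * ν) + S + n * C) + 3 * n  ≡⟨ regroup₂ n ν S C ⟩
  6 * n * (2 * ν * ν) + 3 * n * (2 * C + 1) + 6 * S
    ≡⟨ cong (λ q → 6 * n * (2 * ν * ν) + 3 * n * q + 6 * S) (Σ₁-𝟙[n∣k²]-odd {n} {ν} n≡4ν+r 1≤r r≤3 sf n≡PQ²) ⟩
  6 * n * (2 * ν * ν) + 3 * n * Q + 6 * S ∎
  where
  open ≡-Reasoning
  T = Σ₁ (2 * ν) (λ k → k * k)
  S = Σ₁ (2 * ν) (λ k → Rem (k ^ 2) n)
  C = Σ₁ (2 * ν) (λ k → 𝟙 (n ∣? k * k))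
  twice-cubic : ∀ ν → 2 * (ν * (8 * ν * ν + 6 * ν + 1)) ≡ 2 * ν * (2 * ν + 1) * (2 * (2 * ν) + 1)
  twice-cubic = solve-∀
  regroup₁ : ∀ n F T → 6 * n * F + (6 * T + 3 * n) ≡ 6 * (n * F + T) + 3 * n
  regroup₁ = solve-∀
  regroup₂ : ∀ n ν S C → 6 * (2 * ν * (n * ν) + S + n * C) + 3 * n ≡ 6 * n * (2 * ν * ν) + 3 * n * (2 * C + 1) + 6 * S
  regroup₂ = solve-∀

-- Part (b) multiplied by 48ν, with the subtracted terms moved to the left.
F-identity-even : ∀ ν .{{_ : NonZero ν}} P Q → SquareFree P → 1 ≤ Q → ν ≡ P * (Q * Q) →
  48 * ν * F (4 * ν) + (24 * ν * ν + 4 * ν)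
    ≡ 64 * ν * ν * ν + 48 * ν * Q + 12 * Σ₁ (2 * ν) (λ k → Rem (k ^ 2) (4 * ν))
F-identity-even ν P Q sf 1≤Q ν≡PQ² = +-cancelˡ-≡ (32 * ν * ν * ν) _ _ (begin
  32 * ν * ν * ν + (48 * ν * F n + (24 * ν * ν + 4 * ν))   ≡⟨ regroup₁ ν (F n) ⟩
  48 * ν * F n + 2 * (2 * ν * (2 * ν + 1) * (2 * (2 * ν) + 1)) ≡⟨ cong (λ x → 48 * ν * F n + 2 * x) (Σ₁-squares (2 * ν)) ⟨
  48 * ν * F n + 2 * (6 * T)                               ≡⟨ regroup₂ ν (F n) T ⟩
  12 * (n * F n + T)                                       ≡⟨ cong (12 *_) (F-identity n ν 0 (sym (+-identityʳ n)) z≤n) ⟩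
  12 * (2 * ν * (n * ν) + S + n * C)                       ≡⟨ cong (λ c → 12 * (2 * ν * (n * ν) + S + n * c)) (Σ₁-𝟙[n∣k²]-even sf 1≤Q ν≡PQ²) ⟩
  12 * (2 * ν * (n * ν) + S + n * Q)                       ≡⟨ regroup₃ ν S Q ⟩
  32 * ν * ν * ν + (64 * ν * ν * ν + 48 * ν * Q + 12 * S) ∎)
  where
  open ≡-Reasoning
  n = 4 * ν
  instance
    n≢0 : NonZero n
    n≢0 = m*n≢0 4 ν
  T = Σ₁ (2 * ν) (λ k → k * k)
  S = Σ₁ (2 * ν) (λ k → Rem (k ^ 2) n)
  C = Σ₁ (2 * ν) (λ k → 𝟙 (n ∣? k * k))
  regroup₁ : ∀ ν F → 32 * ν * ν * ν + (48 * ν * F + (24 * ν * ν + 4 * ν))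
                       ≡ 48 * ν * F + 2 * (2 * ν * (2 * ν + 1) * (2 * (2 * ν) + 1))
  regroup₁ = solve-∀
  regroup₂ : ∀ ν F T → 48 * ν * F + 2 * (6 * T) ≡ 12 * (4 * ν * F + T)
  regroup₂ = solve-∀
  regroup₃ : ∀ ν S Q → 12 * (2 * ν * (4 * ν * ν) + S + 4 * ν * Q) ≡ 32 * ν * ν * ν + (64 * ν * ν * ν + 48 * ν * Q + 12 * S)
  regroup₃ = solve-∀

toℚᵘ-ℕ→ℚ : ∀ m → ℚ.toℚᵘ (ℕ→ℚ m) ℚᵘ.≃ mkℚᵘ (ℤ.+ m) 0
toℚᵘ-ℕ→ℚ m = ℚ.toℚᵘ-fromℚᵘ (mkℚᵘ (ℤ.+ m) 0)

ℕ→ℚ-homo-+ : ∀ m n → ℕ→ℚ (m + n) ≡ ℕ→ℚ m +ℚ ℕ→ℚ n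
ℕ→ℚ-homo-+ m n = ℚ.toℚᵘ-injective (begin
  ℚ.toℚᵘ (ℕ→ℚ (m + n))                 ≈⟨ toℚᵘ-ℕ→ℚ (m + n) ⟩
  mkℚᵘ (ℤ.+ (m + n)) 0                 ≈⟨ *≡* (cong (ℤ._* ℤ.+ 1) (trans (ℤ.pos-+ m n) (lemma (ℤ.+ m) (ℤ.+ n)))) ⟩
  mkℚᵘ (ℤ.+ m) 0 ℚᵘ.+ mkℚᵘ (ℤ.+ n) 0    ≈⟨ ℚᵘ.+-cong (toℚᵘ-ℕ→ℚ m) (toℚᵘ-ℕ→ℚ n) ⟨
  ℚ.toℚᵘ (ℕ→ℚ m) ℚᵘ.+ ℚ.toℚᵘ (ℕ→ℚ n)   ≈⟨ ℚ.toℚᵘ-homo-+ (ℕ→ℚ m) (ℕ→ℚ n) ⟨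
  ℚ.toℚᵘ (ℕ→ℚ m +ℚ ℕ→ℚ n) ∎)
  where
  open ℚᵘ.≃-Reasoning
  lemma : ∀ a b → a ℤ.+ b ≡ a ℤ.* ℤ.+ 1 ℤ.+ b ℤ.* ℤ.+ 1
  lemma = ℤ.solve-∀

ℕ→ℚ-homo-* : ∀ m n → ℕ→ℚ (m * n) ≡ ℕ→ℚ m *ℚ ℕ→ℚ n
ℕ→ℚ-homo-* m n = ℚ.toℚᵘ-injective (begin
  ℚ.toℚᵘ (ℕ→ℚ (m * n))                 ≈⟨ toℚᵘ-ℕ→ℚ (m * n) ⟩
  mkℚᵘ (ℤ.+ (m * n)) 0                 ≈⟨ *≡* (cong (ℤ._* ℤ.+ 1) (ℤ.pos-* m n)) ⟩
  mkℚᵘ (ℤ.+ m) 0 ℚᵘ.* mkℚᵘ (ℤ.+ n) 0    ≈⟨ ℚᵘ.*-cong (toℚᵘ-ℕ→ℚ m) (toℚᵘ-ℕ→ℚ n) ⟨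
  ℚ.toℚᵘ (ℕ→ℚ m) ℚᵘ.* ℚ.toℚᵘ (ℕ→ℚ n)   ≈⟨ ℚ.toℚᵘ-homo-* (ℕ→ℚ m) (ℕ→ℚ n) ⟨
  ℚ.toℚᵘ (ℕ→ℚ m *ℚ ℕ→ℚ n) ∎)
  where open ℚᵘ.≃-Reasoning

//-*-ℕ→ℚ : ∀ m N .{{_ : NonZero N}} → m // N *ℚ ℕ→ℚ N ≡ ℕ→ℚ m
//-*-ℕ→ℚ m (suc d) = ℚ.toℚᵘ-injective (begin
  ℚ.toℚᵘ (m // suc d *ℚ ℕ→ℚ (suc d))             ≈⟨ ℚ.toℚᵘ-homo-* (m // suc d) (ℕ→ℚ (suc d)) ⟩
  ℚ.toℚᵘ (m // suc d) ℚᵘ.* ℚ.toℚᵘ (ℕ→ℚ (suc d))   ≈⟨ ℚᵘ.*-cong (ℚ.toℚᵘ-fromℚᵘ (mkℚᵘ (ℤ.+ m) d)) (toℚᵘ-ℕ→ℚ (suc d)) ⟩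
  mkℚᵘ (ℤ.+ m) d ℚᵘ.* mkℚᵘ (ℤ.+ suc d) 0          ≈⟨ *≡* (lemma (ℤ.+ m) (ℤ.+ suc d)) ⟩
  mkℚᵘ (ℤ.+ m) 0                                 ≈⟨ toℚᵘ-ℕ→ℚ m ⟨
  ℚ.toℚᵘ (ℕ→ℚ m) ∎)
  where
  open ℚᵘ.≃-Reasoning
  lemma : ∀ a b → a ℤ.* b ℤ.* ℤ.+ 1 ≡ a ℤ.* (b ℤ.* ℤ.+ 1)
  lemma = ℤ.solve-∀

*-cancelʳ-ℕ→ℚ : ∀ {p q} N .{{_ : NonZero N}} → p *ℚ ℕ→ℚ N ≡ q *ℚ ℕ→ℚ N → p ≡ q
*-cancelʳ-ℕ→ℚ {p} {q} N eq = begin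
  p                          ≡⟨ rescale p ⟩
  p *ℚ ℕ→ℚ N *ℚ (1 // N)     ≡⟨ cong (_*ℚ (1 // N)) eq ⟩
  q *ℚ ℕ→ℚ N *ℚ (1 // N)     ≡⟨ rescale q ⟨
  q ∎
  where
  open ≡-Reasoning
  rescale : ∀ x → x ≡ x *ℚ ℕ→ℚ N *ℚ (1 // N)
  rescale x = begin
    x                          ≡⟨ ℚ.*-identityʳ x ⟨
    x *ℚ ℕ→ℚ 1                 ≡⟨ cong (x *ℚ_) (//-*-ℕ→ℚ 1 N) ⟨
    x *ℚ (1 // N *ℚ ℕ→ℚ N)     ≡⟨ solve 3 (λ x u v → x :* (u :* v) := x :* v :* u) refl x (1 // N) (ℕ→ℚ N) ⟩
    x *ℚ ℕ→ℚ N *ℚ (1 // N) ∎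
    where open +-*-Solver

ℕ→ℚ-≡-by-scaling : ∀ N .{{_ : NonZero N}} x L M (e : ℚ) → N * x + L ≡ M →
  e *ℚ ℕ→ℚ N +ℚ ℕ→ℚ L ≡ ℕ→ℚ M → ℕ→ℚ x ≡ e
ℕ→ℚ-≡-by-scaling N x L M e nat-eq rat-eq =
  *-cancelʳ-ℕ→ℚ N (∙-cancelʳ (ℕ→ℚ L) (ℕ→ℚ x *ℚ ℕ→ℚ N) (e *ℚ ℕ→ℚ N) (begin
    ℕ→ℚ x *ℚ ℕ→ℚ N +ℚ ℕ→ℚ L  ≡⟨ cong (_+ℚ ℕ→ℚ L) (trans (ℚ.*-comm (ℕ→ℚ x) (ℕ→ℚ N)) (sym (ℕ→ℚ-homo-* N x))) ⟩
    ℕ→ℚ (N * x) +ℚ ℕ→ℚ L     ≡⟨ ℕ→ℚ-homo-+ (N * x) L ⟨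
    ℕ→ℚ (N * x + L)          ≡⟨ cong ℕ→ℚ nat-eq ⟩
    ℕ→ℚ M                    ≡⟨ rat-eq ⟨
    e *ℚ ℕ→ℚ N +ℚ ℕ→ℚ L ∎))
  where open ≡-Reasoning

rational-form-odd : ∀ n .{{_ : NonZero n}} F a X Q S →
  6 * n * F + (2 * X + 3 * n) ≡ 6 * n * a + 3 * n * Q + 6 * S →
  ℕ→ℚ F ≡ ℕ→ℚ a -ℚ X // (3 * n) +ℚ (ℕ→ℚ Q -ℚ ℕ→ℚ 1) *ℚ (1 // 2) +ℚ S // n
rational-form-odd n F a X Q S eq =
  ℕ→ℚ-≡-by-scaling (6 * n) {{m*n≢0 6 n}} F (2 * X + 3 * n) (6 * n * a + 3 * n * Q + 6 * S) e eq (begin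
  e *ℚ ι (6 * n) +ℚ ι (2 * X + 3 * n)
    ≡⟨ cong₂ (λ p q → e *ℚ p +ℚ q) (ι* 6 n) (trans (ι+ (2 * X) (3 * n))
         (cong₂ _+ℚ_ (trans (ι* 2 X) (cong (ι 2 *ℚ_) (sym x-scaled))) (ι* 3 n))) ⟩
  e *ℚ (ι 6 *ℚ ι n) +ℚ (ι 2 *ℚ (x *ℚ (ι 3 *ℚ ι n)) +ℚ ι 3 *ℚ ι n)
    ≡⟨ solve 6 (λ a x h s n Q →
         (a :- x :+ (Q :- con (ι 1)) :* h :+ s) :* (con (ι 6) :* n) :+ (con (ι 2) :* (x :* (con (ι 3) :* n)) :+ con (ι 3) :* n)
         := con (ι 6) :* n :* a :+ con (ι 3) :* n :* ((Q :- con (ι 1)) :* (h :* con (ι 2)) :+ con (ι 1)) :+ con (ι 6) :* (s :* n))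
         refl (ι a) x h s (ι n) (ι Q) ⟩
  E (h *ℚ ι 2) (s *ℚ ι n)   ≡⟨ cong₂ E h-scaled s-scaled ⟩
  E (ι 1) (ι S)
    ≡⟨ solve 4 (λ a n Q S →
         con (ι 6) :* n :* a :+ con (ι 3) :* n :* ((Q :- con (ι 1)) :* con (ι 1) :+ con (ι 1)) :+ con (ι 6) :* S
         := con (ι 6) :* n :* a :+ con (ι 3) :* n :* Q :+ con (ι 6) :* S)
         refl (ι a) (ι n) (ι Q) (ι S) ⟩
  ι 6 *ℚ ι n *ℚ ι a +ℚ ι 3 *ℚ ι n *ℚ ι Q +ℚ ι 6 *ℚ ι S
    ≡⟨ cong₂ _+ℚ_ (cong₂ _+ℚ_ (ι*₃ 6 n a) (ι*₃ 3 n Q)) (ι* 6 S) ⟨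
  ι (6 * n * a) +ℚ ι (3 * n * Q) +ℚ ι (6 * S)
    ≡⟨ trans (ι+ (6 * n * a + 3 * n * Q) (6 * S)) (cong (_+ℚ ι (6 * S)) (ι+ (6 * n * a) (3 * n * Q))) ⟨
  ι (6 * n * a + 3 * n * Q + 6 * S) ∎)
  where
  open ≡-Reasoning
  open +-*-Solver
  ι = ℕ→ℚ
  ι+ = ℕ→ℚ-homo-+
  ι* = ℕ→ℚ-homo-*
  ι*₃ : ∀ a b c → ι (a * b * c) ≡ ι a *ℚ ι b *ℚ ι c
  ι*₃ a b c = trans (ι* (a * b) c) (cong (_*ℚ ι c) (ι* a b))
  x = X // (3 * n)
  h = 1 // 2
  s = S // n
  e = ι a -ℚ x +ℚ (ι Q -ℚ ι 1) *ℚ h +ℚ s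
  E : ℚ → ℚ → ℚ
  E p q = ι 6 *ℚ ι n *ℚ ι a +ℚ ι 3 *ℚ ι n *ℚ ((ι Q -ℚ ι 1) *ℚ p +ℚ ι 1) +ℚ ι 6 *ℚ q
  x-scaled : x *ℚ (ι 3 *ℚ ι n) ≡ ι X
  x-scaled = trans (cong (x *ℚ_) (sym (ι* 3 n))) (//-*-ℕ→ℚ X (3 * n) {{m*n≢0 3 n}})
  h-scaled : h *ℚ ι 2 ≡ ι 1
  h-scaled = //-*-ℕ→ℚ 1 2
  s-scaled : s *ℚ ι n ≡ ι S
  s-scaled = //-*-ℕ→ℚ S n

rational-form-even : ∀ ν .{{_ : NonZero ν}} F Q S →
  48 * ν * F + (24 * ν * ν + 4 * ν) ≡ 64 * ν * ν * ν + 48 * ν * Q + 12 * S →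
  ℕ→ℚ F ≡ (4 * ν * ν) // 3 -ℚ ν // 2 -ℚ 1 // 12 +ℚ ℕ→ℚ Q +ℚ S // (4 * ν)
rational-form-even ν F Q S eq =
  ℕ→ℚ-≡-by-scaling (48 * ν) {{m*n≢0 48 ν}} F (24 * ν * ν + 4 * ν) (64 * ν * ν * ν + 48 * ν * Q + 12 * S) e eq (begin
  e *ℚ ι (48 * ν) +ℚ ι (24 * ν * ν + 4 * ν)
    ≡⟨ cong₂ (λ p q → e *ℚ p +ℚ q) (ι* 48 ν) (trans (ι+ (24 * ν * ν) (4 * ν)) (cong₂ _+ℚ_ (ι*₃ 24 ν ν) (ι* 4 ν))) ⟩
  e *ℚ (ι 48 *ℚ v) +ℚ (ι 24 *ℚ v *ℚ v +ℚ ι 4 *ℚ v)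
    ≡⟨ solve 6 (λ v Q a b c w →
         (a :- b :- c :+ Q :+ w) :* (con (ι 48) :* v) :+ (con (ι 24) :* v :* v :+ con (ι 4) :* v)
         := con (ι 16) :* v :* (a :* con (ι 3)) :- con (ι 24) :* v :* (b :* con (ι 2)) :- con (ι 4) :* v :* (c :* con (ι 12))
            :+ con (ι 48) :* v :* Q :+ con (ι 12) :* (w :* (con (ι 4) :* v)) :+ (con (ι 24) :* v :* v :+ con (ι 4) :* v))
         refl v (ι Q) a b c w ⟩
  E (a *ℚ ι 3) (b *ℚ ι 2) (c *ℚ ι 12) (w *ℚ (ι 4 *ℚ v))
    ≡⟨ cong₂ (λ p q → E p q (c *ℚ ι 12) (w *ℚ (ι 4 *ℚ v))) a-scaled b-scaled ⟩
  E (ι 4 *ℚ v *ℚ v) v (c *ℚ ι 12) (w *ℚ (ι 4 *ℚ v))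
    ≡⟨ cong₂ (E (ι 4 *ℚ v *ℚ v) v) c-scaled w-scaled ⟩
  E (ι 4 *ℚ v *ℚ v) v (ι 1) (ι S)
    ≡⟨ solve 3 (λ v Q S →
         con (ι 16) :* v :* (con (ι 4) :* v :* v) :- con (ι 24) :* v :* v :- con (ι 4) :* v :* con (ι 1)
            :+ con (ι 48) :* v :* Q :+ con (ι 12) :* S :+ (con (ι 24) :* v :* v :+ con (ι 4) :* v)
         := con (ι 64) :* v :* v :* v :+ con (ι 48) :* v :* Q :+ con (ι 12) :* S)
         refl v (ι Q) (ι S) ⟩
  ι 64 *ℚ v *ℚ v *ℚ v +ℚ ι 48 *ℚ v *ℚ ι Q +ℚ ι 12 *ℚ ι S
    ≡⟨ cong₂ _+ℚ_ (cong₂ _+ℚ_ (trans (ι* (64 * ν * ν) ν) (cong (_*ℚ v) (ι*₃ 64 ν ν))) (ι*₃ 48 ν Q)) (ι* 12 S) ⟨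
  ι (64 * ν * ν * ν) +ℚ ι (48 * ν * Q) +ℚ ι (12 * S)
    ≡⟨ trans (ι+ (64 * ν * ν * ν + 48 * ν * Q) (12 * S)) (cong (_+ℚ ι (12 * S)) (ι+ (64 * ν * ν * ν) (48 * ν * Q))) ⟨
  ι (64 * ν * ν * ν + 48 * ν * Q + 12 * S) ∎)
  where
  open ≡-Reasoning
  open +-*-Solver
  ι = ℕ→ℚ
  ι+ = ℕ→ℚ-homo-+
  ι* = ℕ→ℚ-homo-*
  ι*₃ : ∀ a b c → ι (a * b * c) ≡ ι a *ℚ ι b *ℚ ι c
  ι*₃ a b c = trans (ι* (a * b) c) (cong (_*ℚ ι c) (ι* a b))
  instance
    4ν≢0 : NonZero (4 * ν)
    4ν≢0 = m*n≢0 4 ν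
  v = ι ν
  a = (4 * ν * ν) // 3
  b = ν // 2
  c = 1 // 12
  w = S // (4 * ν)
  e = a -ℚ b -ℚ c +ℚ ι Q +ℚ w
  E : ℚ → ℚ → ℚ → ℚ → ℚ
  E p q r t = ι 16 *ℚ v *ℚ p -ℚ ι 24 *ℚ v *ℚ q -ℚ ι 4 *ℚ v *ℚ r +ℚ ι 48 *ℚ v *ℚ ι Q +ℚ ι 12 *ℚ t
                +ℚ (ι 24 *ℚ v *ℚ v +ℚ ι 4 *ℚ v)
  a-scaled : a *ℚ ι 3 ≡ ι 4 *ℚ v *ℚ v
  a-scaled = trans (//-*-ℕ→ℚ (4 * ν * ν) 3) (ι*₃ 4 ν ν)
  b-scaled : b *ℚ ι 2 ≡ v
  b-scaled = //-*-ℕ→ℚ ν 2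
  c-scaled : c *ℚ ι 12 ≡ ι 1
  c-scaled = //-*-ℕ→ℚ 1 12
  w-scaled : w *ℚ (ι 4 *ℚ v) ≡ ι S
  w-scaled = trans (cong (w *ℚ_) (sym (ι* 4 ν))) (//-*-ℕ→ℚ S (4 * ν))

proposition2p1 : (n ν r : ℕ) → 1 ≤ n → n ≡ 4 * ν + r → r ≤ 3 →
    (1 ≤ r → ∀ P Q → SquareFree P → 1 ≤ Q → n ≡ P * (Q * Q) →
       ℕ→ℚ (F n) ≡
         ℕ→ℚ (2 * ν * ν) -ℚ (ν * (8 * ν * ν + 6 * ν + 1)) // (3 * n)
           +ℚ (ℕ→ℚ Q -ℚ ℕ→ℚ 1) *ℚ (1 // 2)
           +ℚ Σ₁ (2 * ν) (λ k → Rem (k ^ 2) n) // n)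
    × (r ≡ 0 → ∀ P′ Q′ → SquareFree P′ → 1 ≤ Q′ → ν ≡ P′ * (Q′ * Q′) →
       ℕ→ℚ (F (4 * ν)) ≡
         (4 * ν * ν) // 3 -ℚ ν // 2 -ℚ 1 // 12 +ℚ ℕ→ℚ Q′
           +ℚ Σ₁ (2 * ν) (λ k → Rem (k ^ 2) (4 * ν)) // (4 * ν))
proposition2p1 n@(suc _) ν r _ n≡4ν+r r≤3 =
  (λ 1≤r P Q sf _ n≡PQ² →
    rational-form-odd n (F n) (2 * ν * ν) (ν * (8 * ν * ν + 6 * ν + 1)) Q (Σ₁ (2 * ν) (λ k → Rem (k ^ 2) n))
      (F-identity-odd n ν r P Q n≡4ν+r 1≤r r≤3 sf n≡PQ²)) ,
  λ { refl P′ Q′ sf 1≤Q′ ν≡P′Q′² →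
    rational-form-even ν {{ν≢0 n≡4ν+r}} (F (4 * ν)) Q′ (Σ₁ (2 * ν) (λ k → Rem (k ^ 2) (4 * ν)))
      (F-identity-even ν {{ν≢0 n≡4ν+r}} P′ Q′ sf 1≤Q′ ν≡P′Q′²) }
  where
  ν≢0 : n ≡ 4 * ν + 0 → NonZero ν
  ν≢0 n≡4ν = ≢-nonZero (λ ν≡0 → 1+n≢0 (trans n≡4ν (cong (λ m → 4 * m + 0) ν≡0)))
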